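{- Let $a,b,m,N$ be positive integers with $m\ge 3$ and $N=\frac m2(a-b)+b\ge \frac23 m$. Suppose that $b$ belongs to the interval $\left[\frac12+\sqrt{\frac{6N}{m}-3},\ \frac23+\sqrt{\frac{8N}{m}}\right]$. Then $b^2<4a$ and $3a<b^2+2b+4$. -}

module Defs where

open import Data.Rational using (ℚ; 0ℚ; _≤_; _<_; _*_)
open import Data.Product using (_×_)
open import Data.Sum using (_⊎_)

-- Comparisons with a (real) square root, expressed without reals.
-- For y ≥ 0, √y denotes the unique nonnegative real with (√y)² = y.

-- SqrtLe y x  means  0 ≤ y  and  √y ≤ x
-- (√y ≤ x  iff  x ≥ 0 and y ≤ x², given y ≥ 0).
SqrtLe : ℚ → ℚ → Set
SqrtLe y x = (0ℚ ≤ y) × (0ℚ ≤ x) × (y ≤ x * x)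

-- LeSqrt x y  means  0 ≤ y  and  x ≤ √y
-- (x ≤ √y  iff  x < 0 or x² ≤ y, given y ≥ 0).
LeSqrt : ℚ → ℚ → Set
LeSqrt x y = (0ℚ ≤ y) × ((x < 0ℚ) ⊎ (x * x ≤ y))

module Submission where

-- Write S = m(a − b) + 2b, so that the hypothesis reads 2N = S.
-- Squaring the two endpoint conditions on b and clearing denominators gives
--   (lower)  4(3S − 3m) ≤ m(2b − 1)²        from  √(6N/m − 3) ≤ b − 1/2,
--   (upper)  m(3b − 2)² ≤ 36 S              from  b − 2/3 ≤ √(8N/m),
-- where for the upper bound b − 2/3 > 0 because b ≥ 1.  Both conclusions are
-- then linear consequences of these two quadratic inequalities: the exact ring
-- identities
--   9m·4a         = 9m·b² + (36S − m(3b − 2)²) + 24b(m − 3) + 4m,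
--   4m(b²+2b+4)   = 4m·3a + (m(2b − 1)² − 4(3S − 3m)) + 3m + 24b
-- exhibit 9m·(4a − b²) and 4m·(b² + 2b + 4 − 3a) as a non-negative slack plus
-- a positive term, and the positive factors 9m and 4m cancel.

open import Defs
open import Data.Nat using (ℕ; NonZero; _≤_; _<_; suc; s≤s; z≤n)
import Data.Nat as ℕ
import Data.Nat.Properties as ℕP
open import Data.Integer using (ℤ; +_; 0ℤ; _+_; _*_; -_)
  renaming (_-_ to _-ℤ_; _≤_ to _≤ℤ_; _<_ to _<ℤ_)
import Data.Integer as ℤ
import Data.Integer.Properties as ℤP
open import Data.Integer.Tactic.RingSolver using (solve-∀)
open import Data.Rational using (ℚ; _/_; _-_; toℚᵘ)
import Data.Rational as ℚ
import Data.Rational.Properties as ℚP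
open import Data.Rational.Unnormalised using (ℚᵘ; mkℚᵘ; ↥_; ↧_)
import Data.Rational.Unnormalised as ℚᵘ
import Data.Rational.Unnormalised.Properties as ℚᵘP
open import Relation.Binary.PropositionalEquality
open import Data.Product using (_×_; _,_)
open import Data.Sum using (inj₁; inj₂)
open import Data.Empty using (⊥-elim)

<-+-positive : ∀ x {d} → 0ℤ <ℤ d → x <ℤ x + d
<-+-positive x {d} 0<d = subst (_<ℤ x + d) (ℤP.+-identityʳ x) (ℤP.+-monoʳ-< x 0<d)

0≤-* : ∀ {i j} → 0ℤ ≤ℤ i → 0ℤ ≤ℤ j → 0ℤ ≤ℤ i * j
0≤-* {i} {j} 0≤i 0≤j = ℤP.*-monoʳ-≤-nonNeg j {{ℤ.nonNegative 0≤j}} 0≤i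

-- Normalised rationals
-- do not compute well, so each rational is matched with an unnormalised
-- fraction denoting it; the fraction's numerator and denominator are then
-- explicit ring expressions.

Represents : ℚ → ℚᵘ → Set
Represents q u = toℚᵘ q ℚᵘ.≃ u

rep-/ : ∀ n k → Represents (n / suc k) (mkℚᵘ n k)
rep-/ n k = ℚP.toℚᵘ-fromℚᵘ (mkℚᵘ n k)

rep-- : ∀ p q {u v} → Represents p u → Represents q v → Represents (p - q) (u ℚᵘ.- v)
rep-- p q p≃u q≃v = ℚᵘP.≃-trans (ℚP.toℚᵘ-homo-+ p (ℚ.- q))
  (ℚᵘP.+-cong p≃u (ℚᵘP.≃-trans (ℚP.toℚᵘ-homo‿- q) (ℚᵘP.-‿cong q≃v)))

rep-* : ∀ p q {u v} → Represents p u → Represents q v → Represents (p ℚ.* q) (u ℚᵘ.* v)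
rep-* p q p≃u q≃v = ℚᵘP.≃-trans (ℚP.toℚᵘ-homo-* p q) (ℚᵘP.*-cong p≃u q≃v)

cross-≤ : ∀ {p q u v} → p ℚ.≤ q → Represents p u → Represents q v → ↥ u * ↧ v ≤ℤ ↥ v * ↧ u
cross-≤ p≤q p≃u q≃v with ℚᵘP.≤-respʳ-≃ q≃v (ℚᵘP.≤-respˡ-≃ p≃u (ℚP.toℚᵘ-mono-≤ p≤q))
... | ℚᵘ.*≤* u≤v = u≤v

cross-< : ∀ {p q u v} → p ℚ.< q → Represents p u → Represents q v → ↥ u * ↧ v <ℤ ↥ v * ↧ u
cross-< p<q p≃u q≃v with ℚᵘP.<-respʳ-≃ q≃v (ℚᵘP.<-respˡ-≃ p≃u (ℚP.toℚᵘ-mono-< p<q))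
... | ℚᵘ.*<* u<v = u<v

clear-lower-endpoint : ∀ n b k → SqrtLe ((n / suc k) - (+ 3 / 1)) ((b / 1) - (+ 1 / 2)) →
  + 4 * (n -ℤ + 3 * + suc k) ≤ℤ + suc k * ((+ 2 * b -ℤ + 1) * (+ 2 * b -ℤ + 1))
clear-lower-endpoint n b k (_ , _ , y≤x²) = begin
  + 4 * (n -ℤ + 3 * m)                                                 ≡⟨ lhs n m ⟩
  (n * + 1 + - (+ 3) * m) * + 4                                        ≤⟨ cross-≤ y≤x² y≃ x²≃ ⟩
  ((b * + 2 + - (+ 1) * + 1) * (b * + 2 + - (+ 1) * + 1)) * (m * + 1)  ≡⟨ rhs b m ⟩
  m * ((+ 2 * b -ℤ + 1) * (+ 2 * b -ℤ + 1))                            ∎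
  where
  open ℤP.≤-Reasoning
  m = + suc k
  x = (b / 1) - (+ 1 / 2)
  x≃ = rep-- (b / 1) (+ 1 / 2) (rep-/ b 0) (rep-/ (+ 1) 1)
  y≃ = rep-- (n / suc k) (+ 3 / 1) (rep-/ n k) (rep-/ (+ 3) 0)
  x²≃ = rep-* x x x≃ x≃
  lhs : ∀ n m → + 4 * (n -ℤ + 3 * m) ≡ (n * + 1 + - (+ 3) * m) * + 4
  lhs = solve-∀
  rhs : ∀ b m → ((b * + 2 + - (+ 1) * + 1) * (b * + 2 + - (+ 1) * + 1)) * (m * + 1)
              ≡ m * ((+ 2 * b -ℤ + 1) * (+ 2 * b -ℤ + 1))
  rhs = solve-∀

-- Upper endpoint, denominators cleared: for b ≥ 1, b − 2/3 ≤ √(n/m) with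
-- m = k+1 gives m(3b − 2)² ≤ 9n.  The alternative b − 2/3 < 0 offered by
-- LeSqrt is impossible, since then 3b − 2 < 0.
clear-upper-endpoint : ∀ n b k → + 1 ≤ℤ b → LeSqrt ((b / 1) - (+ 2 / 3)) (n / suc k) →
  + suc k * ((+ 3 * b -ℤ + 2) * (+ 3 * b -ℤ + 2)) ≤ℤ + 9 * n
clear-upper-endpoint n b k 1≤b (_ , inj₁ x<0) =
  ⊥-elim (ℤP.<-asym (cross-< x<0 x≃ ℚᵘP.≃-refl) 3b-2>0)
  where
  x≃ = rep-- (b / 1) (+ 2 / 3) (rep-/ b 0) (rep-/ (+ 2) 2)
  shape : ∀ b → (b * + 3 + - (+ 2) * + 1) * + 1 ≡ + 3 * (b -ℤ + 1) + + 1
  shape = solve-∀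
  3b-2>0 : 0ℤ <ℤ (b * + 3 + - (+ 2) * + 1) * + 1
  3b-2>0 = subst (0ℤ <ℤ_) (sym (shape b))
    (ℤP.≤-<-trans (0≤-* {+ 3} (ℤ.+≤+ z≤n) (ℤP.i≤j⇒0≤j-i 1≤b))
                  (<-+-positive (+ 3 * (b -ℤ + 1)) {+ 1} (ℤ.+<+ (s≤s z≤n))))
clear-upper-endpoint n b k 1≤b (_ , inj₂ x²≤y) = begin
  m * ((+ 3 * b -ℤ + 2) * (+ 3 * b -ℤ + 2))                      ≡⟨ lhs b m ⟩
  ((b * + 3 + - (+ 2) * + 1) * (b * + 3 + - (+ 2) * + 1)) * m    ≤⟨ cross-≤ x²≤y x²≃ (rep-/ n k) ⟩
  n * + 9                                                        ≡⟨ ℤP.*-comm n (+ 9) ⟩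
  + 9 * n                                                        ∎
  where
  open ℤP.≤-Reasoning
  m = + suc k
  x = (b / 1) - (+ 2 / 3)
  x≃ = rep-- (b / 1) (+ 2 / 3) (rep-/ b 0) (rep-/ (+ 2) 2)
  x²≃ = rep-* x x x≃ x≃
  lhs : ∀ b m → m * ((+ 3 * b -ℤ + 2) * (+ 3 * b -ℤ + 2))
              ≡ ((b * + 3 + - (+ 2) * + 1) * (b * + 3 + - (+ 2) * + 1)) * m
  lhs = solve-∀

-- First conclusion over ℤ: if m ≥ 3, b ≥ 0 and m(3b − 2)² ≤ 36(m(a − b) + 2b),
-- then b² < 4a.  The gap 9m(4a − b²) is the slack of the hypothesis plus
-- 24b(m − 3) ≥ 0 plus 4m > 0.
b²<4a : ∀ a b m → + 3 ≤ℤ m → 0ℤ ≤ℤ b →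
  m * ((+ 3 * b -ℤ + 2) * (+ 3 * b -ℤ + 2)) ≤ℤ + 36 * (m * (a -ℤ b) + + 2 * b) →
  b * b <ℤ + 4 * a
b²<4a a b m 3≤m 0≤b upper =
  ℤP.*-cancelˡ-<-nonNeg (+ 9 * m) {{ℤ.nonNegative (0≤-* {+ 9} (ℤ.+≤+ z≤n) (ℤP.<⇒≤ 0<m))}}
    (subst (+ 9 * m * (b * b) <ℤ_) (sym (gap-identity a b m)) (<-+-positive _ gap>0))
  where
  0<m : 0ℤ <ℤ m
  0<m = ℤP.<-≤-trans (ℤ.+<+ (s≤s z≤n)) 3≤m
  gap-identity : ∀ a b m → + 9 * m * (+ 4 * a) ≡ + 9 * m * (b * b)
    + ((+ 36 * (m * (a -ℤ b) + + 2 * b) -ℤ m * ((+ 3 * b -ℤ + 2) * (+ 3 * b -ℤ + 2)))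
       + (+ 24 * (b * (m -ℤ + 3)) + + 4 * m))
  gap-identity = solve-∀
  gap>0 : 0ℤ <ℤ (+ 36 * (m * (a -ℤ b) + + 2 * b) -ℤ m * ((+ 3 * b -ℤ + 2) * (+ 3 * b -ℤ + 2)))
                + (+ 24 * (b * (m -ℤ + 3)) + + 4 * m)
  gap>0 = ℤP.+-mono-≤-< (ℤP.i≤j⇒0≤j-i upper)
    (ℤP.+-mono-≤-< (0≤-* {+ 24} (ℤ.+≤+ z≤n) (0≤-* 0≤b (ℤP.i≤j⇒0≤j-i 3≤m)))
                   (ℤP.*-monoˡ-<-pos (+ 4) 0<m))

-- Second conclusion over ℤ: if m > 0, b ≥ 0 and
-- 4(3(m(a − b) + 2b) − 3m) ≤ m(2b − 1)², then 3a < b² + 2b + 4.  The gap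
-- 4m(b² + 2b + 4 − 3a) is the slack of the hypothesis plus 3m + 24b > 0.
3a<b²+2b+4 : ∀ a b m → 0ℤ <ℤ m → 0ℤ ≤ℤ b →
  + 4 * (+ 3 * (m * (a -ℤ b) + + 2 * b) -ℤ + 3 * m) ≤ℤ m * ((+ 2 * b -ℤ + 1) * (+ 2 * b -ℤ + 1)) →
  + 3 * a <ℤ b * b + + 2 * b + + 4
3a<b²+2b+4 a b m 0<m 0≤b lower =
  ℤP.*-cancelˡ-<-nonNeg (+ 4 * m) {{ℤ.nonNegative (0≤-* {+ 4} (ℤ.+≤+ z≤n) (ℤP.<⇒≤ 0<m))}}
    (subst (+ 4 * m * (+ 3 * a) <ℤ_) (sym (gap-identity a b m)) (<-+-positive _ gap>0))
  where
  gap-identity : ∀ a b m → + 4 * m * (b * b + + 2 * b + + 4) ≡ + 4 * m * (+ 3 * a)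
    + ((m * ((+ 2 * b -ℤ + 1) * (+ 2 * b -ℤ + 1)) -ℤ + 4 * (+ 3 * (m * (a -ℤ b) + + 2 * b) -ℤ + 3 * m))
       + (+ 3 * m + + 24 * b))
  gap-identity = solve-∀
  gap>0 : 0ℤ <ℤ (m * ((+ 2 * b -ℤ + 1) * (+ 2 * b -ℤ + 1)) -ℤ + 4 * (+ 3 * (m * (a -ℤ b) + + 2 * b) -ℤ + 3 * m))
                + (+ 3 * m + + 24 * b)
  gap>0 = ℤP.+-mono-≤-< (ℤP.i≤j⇒0≤j-i lower)
    (ℤP.+-mono-<-≤ (ℤP.*-monoˡ-<-pos (+ 3) 0<m) (0≤-* {+ 24} (ℤ.+≤+ z≤n) 0≤b))

lemma2p2 : (a b m N : ℕ) → .{{_ : NonZero m}} →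
    1 ≤ a → 1 ≤ b → 3 ≤ m → 1 ≤ N →
    ℤ.+ (2 ℕ.* N) ≡ (+ m) ℤ.* ((+ a) ℤ.- (+ b)) ℤ.+ (+ (2 ℕ.* b)) →
    2 ℕ.* m ≤ 3 ℕ.* N →
    SqrtLe ((+ (6 ℕ.* N) / m) - (+ 3 / 1)) ((+ b / 1) - (+ 1 / 2)) →
    LeSqrt ((+ b / 1) - (+ 2 / 3)) (+ (8 ℕ.* N) / m) →
    (b ℕ.* b < 4 ℕ.* a) × (3 ℕ.* a < b ℕ.* b ℕ.+ 2 ℕ.* b ℕ.+ 4)
lemma2p2 a b m@(suc k) N _ 1≤b 3≤m _ 2N≡S _ below above =
  ℤP.drop‿+<+ (subst₂ _<ℤ_ (sym (ℤP.pos-* b b)) (sym (ℤP.pos-* 4 a))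
    (b²<4a (+ a) (+ b) (+ m) (ℤ.+≤+ 3≤m) (ℤ.+≤+ z≤n) upper)) ,
  ℤP.drop‿+<+ (subst₂ _<ℤ_ (sym (ℤP.pos-* 3 a)) (sym cast-rhs)
    (3a<b²+2b+4 (+ a) (+ b) (+ m) (ℤ.+<+ (s≤s z≤n)) (ℤ.+≤+ z≤n) lower))
  where
  open ℤP.≤-Reasoning
  S = + m * (+ a -ℤ + b) + + 2 * + b
  c·2N≡c·S : ∀ c → + (c ℕ.* (2 ℕ.* N)) ≡ + c * S
  c·2N≡c·S c = trans (ℤP.pos-* c (2 ℕ.* N))
    (cong (+ c *_) (trans 2N≡S (cong (λ t → + m * (+ a -ℤ + b) + t) (ℤP.pos-* 2 b))))
  lower : + 4 * (+ 3 * S -ℤ + 3 * + m) ≤ℤ + m * ((+ 2 * + b -ℤ + 1) * (+ 2 * + b -ℤ + 1))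
  lower = begin
    + 4 * (+ 3 * S -ℤ + 3 * + m)       ≡⟨ cong (λ n → + 4 * (n -ℤ + 3 * + m))
                                            (trans (sym (c·2N≡c·S 3)) (cong +_ (sym (ℕP.*-assoc 3 2 N)))) ⟩
    + 4 * (+ (6 ℕ.* N) -ℤ + 3 * + m)   ≤⟨ clear-lower-endpoint (+ (6 ℕ.* N)) (+ b) k below ⟩
    + m * ((+ 2 * + b -ℤ + 1) * (+ 2 * + b -ℤ + 1)) ∎
  upper : + m * ((+ 3 * + b -ℤ + 2) * (+ 3 * + b -ℤ + 2)) ≤ℤ + 36 * S
  upper = begin
    + m * ((+ 3 * + b -ℤ + 2) * (+ 3 * + b -ℤ + 2)) ≤⟨ clear-upper-endpoint (+ (8 ℕ.* N)) (+ b) k (ℤ.+≤+ 1≤b) above ⟩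
    + 9 * + (8 ℕ.* N)   ≡⟨ cong (+ 9 *_) (trans (cong +_ (ℕP.*-assoc 4 2 N)) (c·2N≡c·S 4)) ⟩
    + 9 * (+ 4 * S)     ≡⟨ sym (ℤP.*-assoc (+ 9) (+ 4) S) ⟩
    + 36 * S            ∎
  cast-rhs : + (b ℕ.* b ℕ.+ 2 ℕ.* b ℕ.+ 4) ≡ + b * + b + + 2 * + b + + 4
  cast-rhs = trans (ℤP.pos-+ (b ℕ.* b ℕ.+ 2 ℕ.* b) 4)
    (cong (λ t → t + + 4) (trans (ℤP.pos-+ (b ℕ.* b) (2 ℕ.* b)) (cong₂ _+_ (ℤP.pos-* b b) (ℤP.pos-* 2 b))))
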